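{- For all closed terms $P,Q\in\mathcal{SP}^{\mathsf U}_A$: $\mathrm{EqC\ell FEL}^{\mathsf U}\vdash P=Q$ if and only if $\mathit{clfe}^{\mathsf U}(P)=\mathit{clfe}^{\mathsf U}(Q)$. (That is, the logic $\mathrm{C\ell FEL}$, defined by $\mathrm{C\ell FEL}\models P=Q\iff\mathit{clfe}^{\mathsf U}(P)=\mathit{clfe}^{\mathsf U}(Q)$, is axiomatised by $\mathrm{EqC\ell FEL}^{\mathsf U}$.)
   Context: Let $A$ be a countable set of atoms, totally ordered as $a_1<a_2<\cdots$. $\mathcal{SP}^{\mathsf U}_A$: closed terms generated by $P::=\mathsf T\mid\mathsf F\mid\mathsf U\mid a\mid \neg P\mid P\mathbin{\wedge_\bullet}P\mid P\mathbin{\vee_\bullet}P$ ($a\in A$); $\mathcal{SP}_A$ is the subset of terms not containing $\mathsf U$. $\alpha(P)$ is the set of atoms occurring in $P$. For a string $\beta$ over $A$ with strictly increasing letters: $\widetilde{\mathsf F}_\epsilon=\mathsf F$, $\widetilde{\mathsf F}_{a\rho}=a\mathbin{\wedge_\bullet}\widetilde{\mathsf F}_\rho$. $\mathcal T^{\mathsf U}_A$: $\mathsf T,\mathsf F,\mathsf U\in\mathcal T^{\mathsf U}_A$ and $(X\trianglelefteq a\trianglerighteq Y)\in\mathcal T^{\mathsf U}_A$. Leaf replacement $X[\mathsf T\mapsto Y,\mathsf F\mapsto Z]$ replaces leaves $\mathsf T$ by $Y$, $\mathsf F$ by $Z$, keeps $\mathsf U$; omitted replacements are identities. $\mathit{fe}^{\mathsf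 U}(B)=B$ ($B\in\{\mathsf T,\mathsf F,\mathsf U\}$), $\mathit{fe}^{\mathsf U}(a)=\mathsf T\trianglelefteq a\trianglerighteq\mathsf F$, $\mathit{fe}^{\mathsf U}(\neg P)=\mathit{fe}^{\mathsf U}(P)[\mathsf T\mapsto\mathsf F,\mathsf F\mapsto\mathsf T]$, $\mathit{fe}^{\mathsf U}(P\mathbin{\wedge_\bullet}Q)=\mathit{fe}^{\mathsf U}(P)[\mathsf T\mapsto\mathit{fe}^{\mathsf U}(Q),\mathsf F\mapsto\mathit{fe}^{\mathsf U}(Q)[\mathsf T\mapsto\mathsf F]]$, $\mathit{fe}^{\mathsf U}(P\mathbin{\vee_\bullet}Q)=\mathit{fe}^{\mathsf U}(P)[\mathsf T\mapsto\mathit{fe}^{\mathsf U}(Q)[\mathsf F\mapsto\mathsf T],\mathsf F\mapsto\mathit{fe}^{\mathsf U}(Q)]$. $L_a(B)=R_a(B)=B$ for leaves; $L_a(X\trianglelefteq b\trianglerighteq Y)=L_a(X)$ if $b=a$, else $L_a(X)\trianglelefteq b\trianglerighteq L_a(Y)$; $R_a(X\trianglelefteq b\trianglerighteq Y)=R_a(Y)$ if $b=a$, else $R_a(X)\trianglelefteq b\trianglerighteq R_a(Y)$; $m(B)=B$, $m(X\trianglelefteq a\trianglerighteq Y)=m(L_a(X))\trianglelefteq a\trianglerighteq m(R_a(Y))$; $\mathit{mfe}^{\mathsf U}(P)=m(\mathit{fe}^{\mathsf U}(P))$. $\mathit{clfe}^{\mathsf U}(P)=\mathit{mfe}^{\mathsf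 U}(\widetilde{\mathsf F}_\beta\mathbin{\vee_\bullet}P)$ if $P\in\mathcal{SP}_A$, where $\beta$ is the strictly increasing string with letter set $\alpha(P)$; and $\mathit{clfe}^{\mathsf U}(P)=\mathsf U$ otherwise. $\mathrm{EqFFEL}$: $\mathsf F=\neg\mathsf T$; $x\mathbin{\vee_\bullet}y=\neg(\neg x\mathbin{\wedge_\bullet}\neg y)$; $\neg\neg x=x$; $(x\mathbin{\wedge_\bullet}y)\mathbin{\wedge_\bullet}z=x\mathbin{\wedge_\bullet}(y\mathbin{\wedge_\bullet}z)$; $\mathsf T\mathbin{\wedge_\bullet}x=x$; $x\mathbin{\wedge_\bullet}\mathsf T=x$; $x\mathbin{\wedge_\bullet}\mathsf F=\mathsf F\mathbin{\wedge_\bullet}x$; $\neg x\mathbin{\wedge_\bullet}\mathsf F=x\mathbin{\wedge_\bullet}\mathsf F$; $(x\mathbin{\wedge_\bullet}\mathsf F)\mathbin{\vee_\bullet}y=(x\mathbin{\vee_\bullet}\mathsf T)\mathbin{\wedge_\bullet}y$; $x\mathbin{\vee_\bullet}(y\mathbin{\wedge_\bullet}\mathsf F)=x\mathbin{\wedge_\bullet}(y\mathbin{\vee_\bullet}\mathsf T)$. $\mathrm{EqC\ell FEL}^{\mathsf U}=\mathrm{EqFFEL}\cup\{(x\mathbin{\vee_\bullet}y)\mathbin{\wedge_\bullet}z=(\neg x\mathbin{\wedge_\bullet}(y\mathbin{\wedge_\bullet}z))\mathbin{\vee_\bullet}(x\mathbin{\wedge_\bullet}z),\ \neg\mathsf U=\mathsf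 U,\ \mathsf U\mathbin{\wedge_\bullet}x=\mathsf U,\ x\mathbin{\wedge_\bullet}y=y\mathbin{\wedge_\bullet}x\}$. $\vdash$ is derivability in equational logic. -}

module Defs where

open import Data.Nat using (ℕ; zero; suc; _⊔_; _≟_)
open import Data.Bool using (Bool; true; false; _∨_; if_then_else_)
open import Data.List using (List; []; _∷_; filter; upTo)
open import Data.Empty using (⊥)
open import Relation.Nullary.Decidable using (does)
open import Relation.Binary.PropositionalEquality using (_≡_)

-- Atoms: A = ℕ, with a_i represented by i, ordered by the usual order.
Atom : Set
Atom = ℕ

-- Terms over a set V of variables (for the equational logic);
-- closed terms SP^U_A are Term ⊥.
infixr 6 _∧∙_
infixr 5 _∨∙_
data Term (V : Set) : Set where
  var  : V → Term V
  T F U : Term V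
  atom : Atom → Term V
  ¬′_  : Term V → Term V
  _∧∙_ : Term V → Term V → Term V
  _∨∙_ : Term V → Term V → Term V

SPU : Set
SPU = Term ⊥

noU : SPU → Bool
noU (var ())
noU T = true
noU F = true
noU U = false
noU (atom _) = true
noU (¬′ P) = noU P
noU (P ∧∙ Q) = if noU P then noU Q else false
noU (P ∨∙ Q) = if noU P then noU Q else false

subst : {V W : Set} → (V → Term W) → Term V → Term W
subst σ (var x) = σ x
subst σ T = T
subst σ F = F
subst σ U = U
subst σ (atom a) = atom a
subst σ (¬′ P) = ¬′ subst σ P
subst σ (P ∧∙ Q) = subst σ P ∧∙ subst σ Q
subst σ (P ∨∙ Q) = subst σ P ∨∙ subst σ Q

close : {V : Set} → SPU → Term V
close = subst (λ ())

x y z : Term ℕ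
x = var 0
y = var 1
z = var 2

data Axiom : Term ℕ → Term ℕ → Set where
  F1  : Axiom F (¬′ T)
  F2  : Axiom (x ∨∙ y) (¬′ ((¬′ x) ∧∙ (¬′ y)))
  F3  : Axiom (¬′ (¬′ x)) x
  F4  : Axiom ((x ∧∙ y) ∧∙ z) (x ∧∙ (y ∧∙ z))
  F5  : Axiom (T ∧∙ x) x
  F6  : Axiom (x ∧∙ T) x
  F7  : Axiom (x ∧∙ F) (F ∧∙ x)
  F8  : Axiom ((¬′ x) ∧∙ F) (x ∧∙ F)
  F9  : Axiom ((x ∧∙ F) ∨∙ y) ((x ∨∙ T) ∧∙ y)
  F10 : Axiom (x ∨∙ (y ∧∙ F)) (x ∧∙ (y ∨∙ T))
  C1  : Axiom ((x ∨∙ y) ∧∙ z) (((¬′ x) ∧∙ (y ∧∙ z)) ∨∙ (x ∧∙ z))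
  U1  : Axiom (¬′ U) U
  U2  : Axiom (U ∧∙ x) U
  C2  : Axiom (x ∧∙ y) (y ∧∙ x)

infix 4 ⊢_≈_
data ⊢_≈_ : Term ℕ → Term ℕ → Set where
  ax    : ∀ {s t} (σ : ℕ → Term ℕ) → Axiom s t → ⊢ subst σ s ≈ subst σ t
  refl  : ∀ {t} → ⊢ t ≈ t
  sym   : ∀ {s t} → ⊢ s ≈ t → ⊢ t ≈ s
  trans : ∀ {s t u} → ⊢ s ≈ t → ⊢ t ≈ u → ⊢ s ≈ u
  cong¬ : ∀ {s t} → ⊢ s ≈ t → ⊢ ¬′ s ≈ ¬′ t
  cong∧ : ∀ {s s′ t t′} → ⊢ s ≈ s′ → ⊢ t ≈ t′ → ⊢ s ∧∙ t ≈ s′ ∧∙ t′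
  cong∨ : ∀ {s s′ t t′} → ⊢ s ≈ s′ → ⊢ t ≈ t′ → ⊢ s ∨∙ t ≈ s′ ∨∙ t′

EqClFELU⊢ : SPU → SPU → Set
EqClFELU⊢ P Q = ⊢ close P ≈ close Q

data Tree : Set where
  Tt Ft Ut : Tree
  _⊴_⊵_ : Tree → Atom → Tree → Tree

_[T↦_,F↦_] : Tree → Tree → Tree → Tree
Tt [T↦ Y ,F↦ Z ] = Y
Ft [T↦ Y ,F↦ Z ] = Z
Ut [T↦ Y ,F↦ Z ] = Ut
(X₁ ⊴ a ⊵ X₂) [T↦ Y ,F↦ Z ] = (X₁ [T↦ Y ,F↦ Z ]) ⊴ a ⊵ (X₂ [T↦ Y ,F↦ Z ])

fe : SPU → Tree
fe (var ())
fe T = Tt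
fe F = Ft
fe U = Ut
fe (atom a) = Tt ⊴ a ⊵ Ft
fe (¬′ P) = fe P [T↦ Ft ,F↦ Tt ]
fe (P ∧∙ Q) = fe P [T↦ fe Q ,F↦ (fe Q [T↦ Ft ,F↦ Ft ]) ]
fe (P ∨∙ Q) = fe P [T↦ (fe Q [T↦ Tt ,F↦ Tt ]) ,F↦ fe Q ]

Lt : Atom → Tree → Tree
Lt a Tt = Tt
Lt a Ft = Ft
Lt a Ut = Ut
Lt a (X ⊴ b ⊵ Y) = if does (a ≟ b) then Lt a X else (Lt a X ⊴ b ⊵ Lt a Y)

Rt : Atom → Tree → Tree
Rt a Tt = Tt
Rt a Ft = Ft
Rt a Ut = Ut
Rt a (X ⊴ b ⊵ Y) = if does (a ≟ b) then Rt a Y else (Rt a X ⊴ b ⊵ Rt a Y)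

depth : Tree → ℕ
depth (X ⊴ _ ⊵ Y) = suc (depth X ⊔ depth Y)
depth _ = zero

-- m, computed with fuel (fuel = depth suffices since L_a, R_a do not
-- increase depth)
mfuel : ℕ → Tree → Tree
mfuel zero X = X
mfuel (suc n) Tt = Tt
mfuel (suc n) Ft = Ft
mfuel (suc n) Ut = Ut
mfuel (suc n) (X ⊴ a ⊵ Y) = mfuel n (Lt a X) ⊴ a ⊵ mfuel n (Rt a Y)

m : Tree → Tree
m X = mfuel (depth X) X

mfe : SPU → Tree
mfe P = m (fe P)

occurs : Atom → SPU → Bool
occurs a (var ())
occurs a T = false
occurs a F = false
occurs a U = false
occurs a (atom b) = does (a ≟ b)
occurs a (¬′ P) = occurs a P
occurs a (P ∧∙ Q) = occurs a P ∨ occurs a Q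
occurs a (P ∨∙ Q) = occurs a P ∨ occurs a Q

maxAtom : SPU → ℕ
maxAtom (var ())
maxAtom (atom b) = b
maxAtom (¬′ P) = maxAtom P
maxAtom (P ∧∙ Q) = maxAtom P ⊔ maxAtom Q
maxAtom (P ∨∙ Q) = maxAtom P ⊔ maxAtom Q
maxAtom _ = zero

β : SPU → List Atom
β P = filter (λ a → occurs a P Data.Bool.≟ true) (upTo (suc (maxAtom P)))

F̃ : List Atom → SPU
F̃ [] = F
F̃ (a ∷ ρ) = atom a ∧∙ F̃ ρ

clfe : SPU → Tree
clfe P = if noU P then mfe (F̃ (β P) ∨∙ P) else Ut

module Submission where

-- Soundness: every axiom holds in the algebras of observations of a term (whether it contains U
-- and, if not, whether a given atom occurs in it and its value under a given valuation), so
-- derivably equal terms have the same observations.  These determine clfe: it is Ut when U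
-- occurs, and otherwise the truth table of the term over its atoms β P, because m specialises
-- each atom along every path of the complete tree over β P.
-- Completeness: a term containing U derives U, and a U-free term derives the term read off from
-- its truth table by Shannon expansion P = (a ∧ P[a≔T]) ∨ (¬a ∧ P[a≔F]) along β P.  The
-- expansion needs a to occur in P: then (a ∨ T) ∧ P = P, and under the guard a (resp. ¬a) the
-- atom a may be replaced by T (resp. F).

open import Defs
open import Level using (0ℓ)
open import Data.Nat using (ℕ; zero; suc; _+_; _⊔_; _≤_; z≤n; s≤s; s≤s⁻¹; _≟_)
import Data.Nat.Properties as ℕₚ
open import Data.Bool using (Bool; true; false; not; _∧_; _∨_; if_then_else_) renaming (T to IsTrue)
import Data.Bool as Bool
import Data.Bool.Properties as Boolₚ
open import Data.Empty using (⊥-elim)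
open import Data.Sum using (inj₁; inj₂)
open import Data.Product as Product using (_×_; _,_)
import Data.Product.Properties as Productₚ
open import Data.Maybe as Maybe using (Maybe; just; nothing)
import Data.Maybe.Properties as Maybeₚ
open import Data.List using (List; []; _∷_; [_]; _++_; length; filter; upTo)
open import Data.List.Properties using (upTo-∷ʳ; filter-++; filter-reject; filter-≐; ++-identityʳ)
open import Data.List.Membership.Propositional using (_∈_)
open import Data.List.Membership.Propositional.Properties using (∈-filter⁺; ∈-filter⁻; ∈-upTo⁺)
open import Data.List.Relation.Unary.Any using (here; there)
open import Data.List.Relation.Unary.All as All using (All; []; _∷_)
open import Data.List.Relation.Unary.AllPairs using (_∷_)
open import Data.List.Relation.Unary.Unique.Propositional using (Unique)
import Data.List.Relation.Unary.Unique.Propositional.Properties as Uniqueₚ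
open import Function.Bundles using (_⇔_; mk⇔; module Equivalence)
open import Relation.Nullary using (¬_; Dec)
open import Relation.Nullary.Decidable using (does; proof; True; toWitness)
open import Relation.Nullary.Reflects using (ofʸ; ofⁿ)
open import Relation.Unary using (Pred; Decidable; _≐_)
open import Relation.Binary.Definitions using (DecidableEquality)
open import Relation.Binary.Bundles using (Setoid)
import Relation.Binary.Reasoning.Setoid
open import Relation.Binary.PropositionalEquality as ≡ using (_≡_; _≢_)

open Equivalence using (to; from)

-- Derived equations

assign₃ : {A : Set} → A → A → A → ℕ → A
assign₃ s t u 0 = s
assign₃ s t u 1 = t
assign₃ s t u (suc (suc _)) = u

⊢-setoid : Setoid _ _
⊢-setoid = record
  { Carrier = Term ℕ
  ; _≈_ = ⊢_≈_
  ; isEquivalence = record { refl = refl ; sym = sym ; trans = trans }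
  }

module ⊢-Reasoning = Relation.Binary.Reasoning.Setoid ⊢-setoid

⊢-reflexive : ∀ {s t} → s ≡ t → ⊢ s ≈ t
⊢-reflexive ≡.refl = refl

module _ where
  open ⊢-Reasoning

  F≈¬T : ⊢ F ≈ ¬′ T
  F≈¬T = ax (assign₃ T T T) F1

  ∨-def : ∀ s t → ⊢ s ∨∙ t ≈ ¬′ (¬′ s ∧∙ ¬′ t)
  ∨-def s t = ax (assign₃ s t T) F2

  ¬¬-elim : ∀ s → ⊢ ¬′ ¬′ s ≈ s
  ¬¬-elim s = ax (assign₃ s T T) F3

  ∧-assoc : ∀ s t u → ⊢ (s ∧∙ t) ∧∙ u ≈ s ∧∙ (t ∧∙ u)
  ∧-assoc s t u = ax (assign₃ s t u) F4

  ∧-identityˡ : ∀ s → ⊢ T ∧∙ s ≈ s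
  ∧-identityˡ s = ax (assign₃ s T T) F5

  ∧-identityʳ : ∀ s → ⊢ s ∧∙ T ≈ s
  ∧-identityʳ s = ax (assign₃ s T T) F6

  ¬-∧F : ∀ s → ⊢ ¬′ s ∧∙ F ≈ s ∧∙ F
  ¬-∧F s = ax (assign₃ s T T) F8

  ∧F-∨ : ∀ s t → ⊢ (s ∧∙ F) ∨∙ t ≈ (s ∨∙ T) ∧∙ t
  ∧F-∨ s t = ax (assign₃ s t T) F9

  ∨-∧F : ∀ s t → ⊢ s ∨∙ (t ∧∙ F) ≈ s ∧∙ (t ∨∙ T)
  ∨-∧F s t = ax (assign₃ s t T) F10

  ∨-∧-expand : ∀ s t u → ⊢ (s ∨∙ t) ∧∙ u ≈ (¬′ s ∧∙ (t ∧∙ u)) ∨∙ (s ∧∙ u)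
  ∨-∧-expand s t u = ax (assign₃ s t u) C1

  ¬U : ⊢ ¬′ U ≈ U
  ¬U = ax (assign₃ T T T) U1

  U-∧ : ∀ s → ⊢ U ∧∙ s ≈ U
  U-∧ s = ax (assign₃ s T T) U2

  ∧-comm : ∀ s t → ⊢ s ∧∙ t ≈ t ∧∙ s
  ∧-comm s t = ax (assign₃ s t T) C2

  ∨-comm : ∀ s t → ⊢ s ∨∙ t ≈ t ∨∙ s
  ∨-comm s t = trans (∨-def s t) (trans (cong¬ (∧-comm (¬′ s) (¬′ t))) (sym (∨-def t s)))

  ¬T : ⊢ ¬′ T ≈ F
  ¬T = sym F≈¬T

  ¬F : ⊢ ¬′ F ≈ T
  ¬F = trans (cong¬ F≈¬T) (¬¬-elim T)

  F∧F : ⊢ F ∧∙ F ≈ F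
  F∧F = begin
    F ∧∙ F      ≈⟨ cong∧ F≈¬T refl ⟩
    ¬′ T ∧∙ F   ≈⟨ ¬-∧F T ⟩
    T ∧∙ F      ≈⟨ ∧-identityˡ F ⟩
    F           ∎

  ∨-identityʳ : ∀ s → ⊢ s ∨∙ F ≈ s
  ∨-identityʳ s = begin
    s ∨∙ F               ≈⟨ ∨-def s F ⟩
    ¬′ (¬′ s ∧∙ ¬′ F)    ≈⟨ cong¬ (cong∧ refl ¬F) ⟩
    ¬′ (¬′ s ∧∙ T)       ≈⟨ cong¬ (∧-identityʳ (¬′ s)) ⟩
    ¬′ ¬′ s              ≈⟨ ¬¬-elim s ⟩
    s                    ∎

  ∨-identityˡ : ∀ s → ⊢ F ∨∙ s ≈ s
  ∨-identityˡ s = trans (∨-comm F s) (∨-identityʳ s)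

  ∨T≈¬∧F : ∀ s → ⊢ s ∨∙ T ≈ ¬′ (s ∧∙ F)
  ∨T≈¬∧F s = begin
    s ∨∙ T               ≈⟨ ∨-def s T ⟩
    ¬′ (¬′ s ∧∙ ¬′ T)    ≈⟨ cong¬ (cong∧ refl ¬T) ⟩
    ¬′ (¬′ s ∧∙ F)       ≈⟨ cong¬ (¬-∧F s) ⟩
    ¬′ (s ∧∙ F)          ∎

  ∨T-∧ : ∀ s u → ⊢ (s ∨∙ T) ∧∙ u ≈ (s ∧∙ u) ∨∙ (¬′ s ∧∙ u)
  ∨T-∧ s u = begin
    (s ∨∙ T) ∧∙ u                   ≈⟨ ∨-∧-expand s T u ⟩
    (¬′ s ∧∙ (T ∧∙ u)) ∨∙ (s ∧∙ u)  ≈⟨ cong∨ (cong∧ refl (∧-identityˡ u)) refl ⟩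
    (¬′ s ∧∙ u) ∨∙ (s ∧∙ u)         ≈⟨ ∨-comm _ _ ⟩
    (s ∧∙ u) ∨∙ (¬′ s ∧∙ u)         ∎

  ∨T-∧-self : ∀ s → ⊢ (s ∨∙ T) ∧∙ s ≈ s
  ∨T-∧-self s = begin
    (s ∨∙ T) ∧∙ s                   ≈⟨ ∧F-∨ s s ⟨
    (s ∧∙ F) ∨∙ s                   ≈⟨ cong∨ (¬-∧F s) refl ⟨
    (¬′ s ∧∙ F) ∨∙ s                ≈⟨ cong∨ (cong∧ refl (∧-identityʳ F)) (∧-identityʳ s) ⟨
    (¬′ s ∧∙ (F ∧∙ T)) ∨∙ (s ∧∙ T)  ≈⟨ ∨-∧-expand s F T ⟨
    (s ∨∙ F) ∧∙ T                   ≈⟨ ∧-identityʳ _ ⟩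
    s ∨∙ F                          ≈⟨ ∨-identityʳ s ⟩
    s                               ∎

  ¬-∨-self : ∀ s → ⊢ ¬′ s ∨∙ s ≈ s ∨∙ T
  ¬-∨-self s = begin
    ¬′ s ∨∙ s                       ≈⟨ ∨-comm _ _ ⟩
    s ∨∙ ¬′ s                       ≈⟨ cong∨ (∧-identityʳ s) (∧-identityʳ (¬′ s)) ⟨
    (s ∧∙ T) ∨∙ (¬′ s ∧∙ T)         ≈⟨ ∨T-∧ s T ⟨
    (s ∨∙ T) ∧∙ T                   ≈⟨ ∧-identityʳ _ ⟩
    s ∨∙ T                          ∎

  ∧-¬-self : ∀ s → ⊢ s ∧∙ ¬′ s ≈ s ∧∙ F
  ∧-¬-self s = begin
    s ∧∙ ¬′ s              ≈⟨ ¬¬-elim _ ⟨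
    ¬′ ¬′ (s ∧∙ ¬′ s)      ≈⟨ cong¬ (cong¬ (cong∧ (¬¬-elim s) refl)) ⟨
    ¬′ ¬′ (¬′ ¬′ s ∧∙ ¬′ s) ≈⟨ cong¬ (∨-def (¬′ s) s) ⟨
    ¬′ (¬′ s ∨∙ s)         ≈⟨ cong¬ (¬-∨-self s) ⟩
    ¬′ (s ∨∙ T)            ≈⟨ cong¬ (∨T≈¬∧F s) ⟩
    ¬′ ¬′ (s ∧∙ F)         ≈⟨ ¬¬-elim _ ⟩
    s ∧∙ F                 ∎

  ¬-∧-self : ∀ s → ⊢ ¬′ s ∧∙ s ≈ s ∧∙ F
  ¬-∧-self s = trans (∧-comm (¬′ s) s) (∧-¬-self s)

  ∧-idem : ∀ s → ⊢ s ∧∙ s ≈ s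
  ∧-idem s = begin
    s ∧∙ s                          ≈⟨ cong∧ refl (∨T-∧-self s) ⟨
    s ∧∙ ((s ∨∙ T) ∧∙ s)            ≈⟨ cong∧ refl (∧-comm _ _) ⟩
    s ∧∙ (s ∧∙ (s ∨∙ T))            ≈⟨ ∧-assoc s s _ ⟨
    (s ∧∙ s) ∧∙ (s ∨∙ T)            ≈⟨ ∨-∧F (s ∧∙ s) s ⟨
    (s ∧∙ s) ∨∙ (s ∧∙ F)            ≈⟨ cong∨ refl (¬-∧-self s) ⟨
    (s ∧∙ s) ∨∙ (¬′ s ∧∙ s)         ≈⟨ ∨T-∧ s s ⟨
    (s ∨∙ T) ∧∙ s                   ≈⟨ ∨T-∧-self s ⟩
    s                               ∎

  ∧-∨-∧F : ∀ s t → ⊢ s ∧∙ t ≈ (s ∧∙ t) ∨∙ (t ∧∙ F)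
  ∧-∨-∧F s t = begin
    s ∧∙ t                             ≈⟨ cong∧ (∨-identityˡ s) refl ⟨
    (F ∨∙ s) ∧∙ t                      ≈⟨ ∨-∧-expand F s t ⟩
    (¬′ F ∧∙ (s ∧∙ t)) ∨∙ (F ∧∙ t)     ≈⟨ cong∨ (trans (cong∧ ¬F refl) (∧-identityˡ _)) (∧-comm F t) ⟩
    (s ∧∙ t) ∨∙ (t ∧∙ F)               ∎

  ∧-¬-guarded : ∀ s t → ⊢ s ∧∙ ¬′ t ≈ s ∧∙ ¬′ (s ∧∙ t)
  ∧-¬-guarded s t = begin
    s ∧∙ ¬′ t                                  ≈⟨ ∧-comm _ _ ⟩
    ¬′ t ∧∙ s                                  ≈⟨ ∧-∨-∧F (¬′ t) s ⟩
    (¬′ t ∧∙ s) ∨∙ (s ∧∙ F)                    ≈⟨ cong∨ s∧¬t∧s refl ⟨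
    (s ∧∙ (¬′ t ∧∙ s)) ∨∙ (s ∧∙ F)             ≈⟨ cong∨ (cong∧ (¬¬-elim s) refl) (¬-∧-self s) ⟨
    (¬′ ¬′ s ∧∙ (¬′ t ∧∙ s)) ∨∙ (¬′ s ∧∙ s)    ≈⟨ ∨-∧-expand (¬′ s) (¬′ t) s ⟨
    (¬′ s ∨∙ ¬′ t) ∧∙ s                        ≈⟨ cong∧ ¬∧ refl ⟩
    ¬′ (s ∧∙ t) ∧∙ s                           ≈⟨ ∧-comm _ _ ⟩
    s ∧∙ ¬′ (s ∧∙ t)                           ∎
    where
    ¬∧ : ⊢ ¬′ s ∨∙ ¬′ t ≈ ¬′ (s ∧∙ t)
    ¬∧ = trans (∨-def (¬′ s) (¬′ t)) (cong¬ (cong∧ (¬¬-elim s) (¬¬-elim t)))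
    s∧¬t∧s : ⊢ s ∧∙ (¬′ t ∧∙ s) ≈ ¬′ t ∧∙ s
    s∧¬t∧s = begin
      s ∧∙ (¬′ t ∧∙ s)    ≈⟨ cong∧ refl (∧-comm _ _) ⟩
      s ∧∙ (s ∧∙ ¬′ t)    ≈⟨ ∧-assoc s s _ ⟨
      (s ∧∙ s) ∧∙ ¬′ t    ≈⟨ cong∧ (∧-idem s) refl ⟩
      s ∧∙ ¬′ t           ≈⟨ ∧-comm _ _ ⟩
      ¬′ t ∧∙ s           ∎

  ∧-distribˡ-∧ : ∀ s t u → ⊢ s ∧∙ (t ∧∙ u) ≈ (s ∧∙ t) ∧∙ (s ∧∙ u)
  ∧-distribˡ-∧ s t u = begin
    s ∧∙ (t ∧∙ u)          ≈⟨ cong∧ (∧-idem s) refl ⟨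
    (s ∧∙ s) ∧∙ (t ∧∙ u)   ≈⟨ ∧-assoc _ _ _ ⟩
    s ∧∙ (s ∧∙ (t ∧∙ u))   ≈⟨ cong∧ refl (∧-assoc s t u) ⟨
    s ∧∙ ((s ∧∙ t) ∧∙ u)   ≈⟨ cong∧ refl (cong∧ (∧-comm s t) refl) ⟩
    s ∧∙ ((t ∧∙ s) ∧∙ u)   ≈⟨ cong∧ refl (∧-assoc t s u) ⟩
    s ∧∙ (t ∧∙ (s ∧∙ u))   ≈⟨ ∧-assoc _ _ _ ⟨
    (s ∧∙ t) ∧∙ (s ∧∙ u)   ∎

  ∨T-∧-¬ : ∀ w t → ⊢ (w ∨∙ T) ∧∙ ¬′ t ≈ ¬′ ((w ∨∙ T) ∧∙ t)
  ∨T-∧-¬ w t = begin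
    (w ∨∙ T) ∧∙ ¬′ t                ≈⟨ ∧F-∨ w (¬′ t) ⟨
    (w ∧∙ F) ∨∙ ¬′ t                ≈⟨ ∨-def _ _ ⟩
    ¬′ (¬′ (w ∧∙ F) ∧∙ ¬′ ¬′ t)     ≈⟨ cong¬ (cong∧ (∨T≈¬∧F w) (sym (¬¬-elim t))) ⟨
    ¬′ ((w ∨∙ T) ∧∙ t)              ∎

  ∧-zeroʳ-U : ∀ s → ⊢ s ∧∙ U ≈ U
  ∧-zeroʳ-U s = trans (∧-comm s U) (U-∧ s)

  ∨-zeroˡ-U : ∀ s → ⊢ U ∨∙ s ≈ U
  ∨-zeroˡ-U s = begin
    U ∨∙ s              ≈⟨ ∨-def U s ⟩
    ¬′ (¬′ U ∧∙ ¬′ s)   ≈⟨ cong¬ (cong∧ ¬U refl) ⟩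
    ¬′ (U ∧∙ ¬′ s)      ≈⟨ cong¬ (U-∧ _) ⟩
    ¬′ U                ≈⟨ ¬U ⟩
    U                   ∎

  ∨-zeroʳ-U : ∀ s → ⊢ s ∨∙ U ≈ U
  ∨-zeroʳ-U s = trans (∨-comm s U) (∨-zeroˡ-U s)

bool : ∀ {V} → Bool → Term V
bool true = T
bool false = F

close-bool : ∀ b → close (bool b) ≡ bool {ℕ} b
close-bool true = ≡.refl
close-bool false = ≡.refl

bool-¬ : ∀ b → ⊢ ¬′ bool b ≈ bool (not b)
bool-¬ true = ¬T
bool-¬ false = ¬F

bool-∧ : ∀ b c → ⊢ bool b ∧∙ bool c ≈ bool (b ∧ c)
bool-∧ true c = ∧-identityˡ (bool c)
bool-∧ false true = ∧-identityʳ F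
bool-∧ false false = F∧F

bool-∨ : ∀ b c → ⊢ bool b ∨∙ bool c ≈ bool (b ∨ c)
bool-∨ true true = trans (∨T≈¬∧F T) (trans (cong¬ (∧-identityˡ F)) ¬F)
bool-∨ true false = ∨-identityʳ T
bool-∨ false c = ∨-identityˡ (bool c)

U-absorbs : ∀ P → noU P ≡ false → ⊢ close P ≈ U
U-absorbs (var ())
U-absorbs U _ = refl
U-absorbs (¬′ P) h = trans (cong¬ (U-absorbs P h)) ¬U
U-absorbs (P ∧∙ Q) h with noU P in uP
... | false = trans (cong∧ (U-absorbs P uP) refl) (U-∧ _)
... | true = trans (cong∧ refl (U-absorbs Q h)) (∧-zeroʳ-U _)
U-absorbs (P ∨∙ Q) h with noU P in uP
... | false = trans (cong∨ (U-absorbs P uP) refl) (∨-zeroˡ-U _)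
... | true = trans (cong∨ refl (U-absorbs Q h)) (∨-zeroʳ-U _)

-- Shannon expansion

_occursIn_ : Atom → SPU → Set
c occursIn P = IsTrue (occurs c P)

_[_≔_] : SPU → Atom → Bool → SPU
var () [ a ≔ b ]
T [ a ≔ b ] = T
F [ a ≔ b ] = F
U [ a ≔ b ] = U
atom c [ a ≔ b ] = if does (a ≟ c) then bool b else atom c
(¬′ P) [ a ≔ b ] = ¬′ (P [ a ≔ b ])
(P ∧∙ Q) [ a ≔ b ] = (P [ a ≔ b ]) ∧∙ (Q [ a ≔ b ])
(P ∨∙ Q) [ a ≔ b ] = (P [ a ≔ b ]) ∨∙ (Q [ a ≔ b ])

-- Evaluating w first, and discarding its value, does not change p.
Evaluates : Term ℕ → Term ℕ → Set
Evaluates w p = ⊢ (w ∨∙ T) ∧∙ p ≈ p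

module _ {w : Term ℕ} where

  evaluates-¬ : ∀ {p} → Evaluates w p → Evaluates w (¬′ p)
  evaluates-¬ {p} h = trans (∨T-∧-¬ w p) (cong¬ h)

  evaluates-∧ˡ : ∀ {p} q → Evaluates w p → Evaluates w (p ∧∙ q)
  evaluates-∧ˡ {p} q h = trans (sym (∧-assoc (w ∨∙ T) p q)) (cong∧ h refl)

  evaluates-∧ʳ : ∀ p {q} → Evaluates w q → Evaluates w (p ∧∙ q)
  evaluates-∧ʳ p {q} h =
    trans (cong∧ refl (∧-comm p q)) (trans (evaluates-∧ˡ p h) (∧-comm q p))

  evaluates-∨ˡ : ∀ {p} q → Evaluates w p → Evaluates w (p ∨∙ q)
  evaluates-∨ˡ {p} q h = trans (cong∧ refl (∨-def p q))
    (trans (evaluates-¬ (evaluates-∧ˡ (¬′ q) (evaluates-¬ h))) (sym (∨-def p q)))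

  evaluates-∨ʳ : ∀ p {q} → Evaluates w q → Evaluates w (p ∨∙ q)
  evaluates-∨ʳ p {q} h =
    trans (cong∧ refl (∨-comm p q)) (trans (evaluates-∨ˡ p h) (∨-comm q p))

occurs⇒evaluates : ∀ {a} P → a occursIn P → Evaluates (atom a) (close P)
occurs⇒evaluates (var ())
-- does (a ≟ c) reduces to a ≡ᵇ c, which `with a ≟ c` would not abstract.
occurs⇒evaluates {a} (atom c) o with does (a ≟ c) | proof (a ≟ c)
... | true | ofʸ ≡.refl = ∨T-∧-self (atom a)
occurs⇒evaluates (¬′ P) o = evaluates-¬ (occurs⇒evaluates P o)
occurs⇒evaluates (P ∧∙ Q) o with to Boolₚ.T-∨ o
... | inj₁ oP = evaluates-∧ˡ (close Q) (occurs⇒evaluates P oP)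
... | inj₂ oQ = evaluates-∧ʳ (close P) (occurs⇒evaluates Q oQ)
occurs⇒evaluates (P ∨∙ Q) o with to Boolₚ.T-∨ o
... | inj₁ oP = evaluates-∨ˡ (close Q) (occurs⇒evaluates P oP)
... | inj₂ oQ = evaluates-∨ʳ (close P) (occurs⇒evaluates Q oQ)

module _ (g : Term ℕ) where

  guarded-¬ : ∀ {p q} → ⊢ g ∧∙ p ≈ g ∧∙ q → ⊢ g ∧∙ ¬′ p ≈ g ∧∙ ¬′ q
  guarded-¬ {p} {q} h = trans (∧-¬-guarded g p) (trans (cong∧ refl (cong¬ h)) (sym (∧-¬-guarded g q)))

  guarded-∧ : ∀ {p q p′ q′} → ⊢ g ∧∙ p ≈ g ∧∙ p′ → ⊢ g ∧∙ q ≈ g ∧∙ q′ →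
              ⊢ g ∧∙ (p ∧∙ q) ≈ g ∧∙ (p′ ∧∙ q′)
  guarded-∧ {p} {q} {p′} {q′} hp hq =
    trans (∧-distribˡ-∧ g p q) (trans (cong∧ hp hq) (sym (∧-distribˡ-∧ g p′ q′)))

  guarded-∨ : ∀ {p q p′ q′} → ⊢ g ∧∙ p ≈ g ∧∙ p′ → ⊢ g ∧∙ q ≈ g ∧∙ q′ →
              ⊢ g ∧∙ (p ∨∙ q) ≈ g ∧∙ (p′ ∨∙ q′)
  guarded-∨ hp hq = trans (cong∧ refl (∨-def _ _))
    (trans (guarded-¬ (guarded-∧ (guarded-¬ hp) (guarded-¬ hq))) (cong∧ refl (sym (∨-def _ _))))

  guarded-≔ : ∀ {a b} → ⊢ g ∧∙ atom a ≈ g ∧∙ bool b →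
              ∀ P → ⊢ g ∧∙ close P ≈ g ∧∙ close (P [ a ≔ b ])
  guarded-≔ h (var ())
  guarded-≔ h T = refl
  guarded-≔ h F = refl
  guarded-≔ h U = refl
  guarded-≔ {a} {b} h (atom c) with does (a ≟ c) | proof (a ≟ c)
  ... | true | ofʸ ≡.refl = trans h (cong∧ refl (⊢-reflexive (≡.sym (close-bool b))))
  ... | false | ofⁿ _ = refl
  guarded-≔ h (¬′ P) = guarded-¬ (guarded-≔ h P)
  guarded-≔ h (P ∧∙ Q) = guarded-∧ (guarded-≔ h P) (guarded-≔ h Q)
  guarded-≔ h (P ∨∙ Q) = guarded-∨ (guarded-≔ h P) (guarded-≔ h Q)

shannon-expansion : ∀ {a} P → a occursIn P →
  ⊢ close P ≈ (atom a ∧∙ close (P [ a ≔ true ])) ∨∙ (¬′ atom a ∧∙ close (P [ a ≔ false ]))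
shannon-expansion {a} P o = begin
  close P                                        ≈⟨ occurs⇒evaluates P o ⟨
  (atom a ∨∙ T) ∧∙ close P                       ≈⟨ ∨T-∧ (atom a) (close P) ⟩
  (atom a ∧∙ close P) ∨∙ (¬′ atom a ∧∙ close P)  ≈⟨ cong∨ (guarded-≔ (atom a) a∧a P)
                                                           (guarded-≔ (¬′ atom a) ¬a∧a P) ⟩
  (atom a ∧∙ close (P [ a ≔ true ])) ∨∙ (¬′ atom a ∧∙ close (P [ a ≔ false ])) ∎
  where
  open ⊢-Reasoning
  a∧a : ⊢ atom a ∧∙ atom a ≈ atom a ∧∙ T
  a∧a = trans (∧-idem _) (sym (∧-identityʳ _))
  ¬a∧a : ⊢ ¬′ atom a ∧∙ atom a ≈ ¬′ atom a ∧∙ F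
  ¬a∧a = trans (¬-∧-self _) (sym (¬-∧F _))

-- Observations and soundness

-- U gets an arbitrary value: eval is only consulted on U-free terms.
eval : (Atom → Bool) → SPU → Bool
eval v (var ())
eval v T = true
eval v F = false
eval v U = false
eval v (atom c) = v c
eval v (¬′ P) = not (eval v P)
eval v (P ∧∙ Q) = eval v P ∧ eval v Q
eval v (P ∨∙ Q) = eval v P ∨ eval v Q

-- nothing: the term contains U; just (o , b): whether the observed atom occurs, and the value
-- under the observed valuation.
Obs : Set
Obs = Maybe (Bool × Bool)

map-if : ∀ {A B : Set} {f : A → B} {x} p →
         Maybe.map f (if p then just x else nothing) ≡ (if p then just (f x) else nothing)
map-if true = ≡.refl
map-if false = ≡.refl

zipWith-if : ∀ {A B C : Set} {f : A → B → C} {x y} p q →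
             Maybe.zipWith f (if p then just x else nothing) (if q then just y else nothing)
             ≡ (if (if p then q else false) then just (f x y) else nothing)
zipWith-if true true = ≡.refl
zipWith-if true false = ≡.refl
zipWith-if false q = ≡.refl

observe : Atom → (Atom → Bool) → SPU → Obs
observe a v P = if noU P then just (occurs a P , eval v P) else nothing

if-just-injective : ∀ {A : Set} p q {x y : A} →
  (if p then just x else nothing) ≡ (if q then just y else nothing) → p ≡ q
if-just-injective true true _ = ≡.refl
if-just-injective false false _ = ≡.refl

combine : (Bool → Bool → Bool) → Bool × Bool → Bool × Bool → Bool × Bool
combine f (o , b) (o′ , b′) = (o ∨ o′ , f b b′)

module Observation (a : Atom) (v : Atom → Bool) where

  ⟦_⟧ : ∀ {V} → Term V → (V → Obs) → Obs
  ⟦ var x ⟧ ρ = ρ x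
  ⟦ T ⟧ ρ = just (false , true)
  ⟦ F ⟧ ρ = just (false , false)
  ⟦ U ⟧ ρ = nothing
  ⟦ atom c ⟧ ρ = just (does (a ≟ c) , v c)
  ⟦ ¬′ s ⟧ ρ = Maybe.map (Product.map₂ not) (⟦ s ⟧ ρ)
  ⟦ s ∧∙ t ⟧ ρ = Maybe.zipWith (combine _∧_) (⟦ s ⟧ ρ) (⟦ t ⟧ ρ)
  ⟦ s ∨∙ t ⟧ ρ = Maybe.zipWith (combine _∨_) (⟦ s ⟧ ρ) (⟦ t ⟧ ρ)

  ⟦⟧-subst : ∀ {V W} (σ : V → Term W) t ρ → ⟦ subst σ t ⟧ ρ ≡ ⟦ t ⟧ (λ x → ⟦ σ x ⟧ ρ)
  ⟦⟧-subst σ (var x) ρ = ≡.refl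
  ⟦⟧-subst σ T ρ = ≡.refl
  ⟦⟧-subst σ F ρ = ≡.refl
  ⟦⟧-subst σ U ρ = ≡.refl
  ⟦⟧-subst σ (atom c) ρ = ≡.refl
  ⟦⟧-subst σ (¬′ t) ρ = ≡.cong (Maybe.map _) (⟦⟧-subst σ t ρ)
  ⟦⟧-subst σ (s ∧∙ t) ρ = ≡.cong₂ (Maybe.zipWith _) (⟦⟧-subst σ s ρ) (⟦⟧-subst σ t ρ)
  ⟦⟧-subst σ (s ∨∙ t) ρ = ≡.cong₂ (Maybe.zipWith _) (⟦⟧-subst σ s ρ) (⟦⟧-subst σ t ρ)

  obs-values : List Obs
  obs-values = nothing ∷ just (false , false) ∷ just (false , true) ∷ just (true , false) ∷ just (true , true) ∷ []

  every-obs : ∀ {p} {Pr : Obs → Set p} → All Pr obs-values → ∀ o → Pr o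
  every-obs (n ∷ _) nothing = n
  every-obs (_ ∷ ff ∷ _) (just (false , false)) = ff
  every-obs (_ ∷ _ ∷ ft ∷ _) (just (false , true)) = ft
  every-obs (_ ∷ _ ∷ _ ∷ tf ∷ _) (just (true , false)) = tf
  every-obs (_ ∷ _ ∷ _ ∷ _ ∷ tt ∷ _) (just (true , true)) = tt

  _≟ₒ_ : DecidableEquality Obs
  _≟ₒ_ = Maybeₚ.≡-dec (Productₚ.≡-dec Boolₚ._≟_ Boolₚ._≟_)

  valid-everywhere? : (l r : Term ℕ) →
    Dec (All (λ o₀ → All (λ o₁ → All (λ o₂ → ⟦ l ⟧ (assign₃ o₀ o₁ o₂) ≡ ⟦ r ⟧ (assign₃ o₀ o₁ o₂))
      obs-values) obs-values) obs-values)
  valid-everywhere? l r = All.all? (λ o₀ → All.all? (λ o₁ → All.all? (λ o₂ →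
    ⟦ l ⟧ (assign₃ o₀ o₁ o₂) ≟ₒ ⟦ r ⟧ (assign₃ o₀ o₁ o₂)) obs-values) obs-values) obs-values

  valid-by-exhaustion : ∀ l r → True (valid-everywhere? l r) →
    ∀ (ρ : ℕ → Obs) → ⟦ l ⟧ (assign₃ (ρ 0) (ρ 1) (ρ 2)) ≡ ⟦ r ⟧ (assign₃ (ρ 0) (ρ 1) (ρ 2))
  valid-by-exhaustion l r ok ρ = every-obs (every-obs (every-obs (toWitness ok) (ρ 0)) (ρ 1)) (ρ 2)

  -- Each axiom is in the variables x, y, z; it is checked on all 5³ assignments of observations.
  axiom-valid : ∀ {l r} → Axiom l r → ∀ ρ → ⟦ l ⟧ ρ ≡ ⟦ r ⟧ ρ
  axiom-valid {l} {r} F1 = valid-by-exhaustion l r _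
  axiom-valid {l} {r} F2 = valid-by-exhaustion l r _
  axiom-valid {l} {r} F3 = valid-by-exhaustion l r _
  axiom-valid {l} {r} F4 = valid-by-exhaustion l r _
  axiom-valid {l} {r} F5 = valid-by-exhaustion l r _
  axiom-valid {l} {r} F6 = valid-by-exhaustion l r _
  axiom-valid {l} {r} F7 = valid-by-exhaustion l r _
  axiom-valid {l} {r} F8 = valid-by-exhaustion l r _
  axiom-valid {l} {r} F9 = valid-by-exhaustion l r _
  axiom-valid {l} {r} F10 = valid-by-exhaustion l r _
  axiom-valid {l} {r} C1 = valid-by-exhaustion l r _
  axiom-valid {l} {r} U1 = valid-by-exhaustion l r _
  axiom-valid {l} {r} U2 = valid-by-exhaustion l r _
  axiom-valid {l} {r} C2 = valid-by-exhaustion l r _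

  sound : ∀ {s t} → ⊢ s ≈ t → ∀ ρ → ⟦ s ⟧ ρ ≡ ⟦ t ⟧ ρ
  sound (ax {s} {t} σ A) ρ =
    ≡.trans (⟦⟧-subst σ s ρ) (≡.trans (axiom-valid A _) (≡.sym (⟦⟧-subst σ t ρ)))
  sound refl ρ = ≡.refl
  sound (sym d) ρ = ≡.sym (sound d ρ)
  sound (trans d e) ρ = ≡.trans (sound d ρ) (sound e ρ)
  sound (cong¬ d) ρ = ≡.cong (Maybe.map _) (sound d ρ)
  sound (cong∧ d e) ρ = ≡.cong₂ (Maybe.zipWith _) (sound d ρ) (sound e ρ)
  sound (cong∨ d e) ρ = ≡.cong₂ (Maybe.zipWith _) (sound d ρ) (sound e ρ)

  ⟦close⟧ : ∀ P (ρ : ℕ → Obs) → ⟦ close P ⟧ ρ ≡ observe a v P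
  ⟦close⟧ (var ())
  ⟦close⟧ T ρ = ≡.refl
  ⟦close⟧ F ρ = ≡.refl
  ⟦close⟧ U ρ = ≡.refl
  ⟦close⟧ (atom c) ρ = ≡.refl
  ⟦close⟧ (¬′ P) ρ = ≡.trans (≡.cong (Maybe.map _) (⟦close⟧ P ρ)) (map-if (noU P))
  ⟦close⟧ (P ∧∙ Q) ρ =
    ≡.trans (≡.cong₂ (Maybe.zipWith _) (⟦close⟧ P ρ) (⟦close⟧ Q ρ)) (zipWith-if (noU P) (noU Q))
  ⟦close⟧ (P ∨∙ Q) ρ =
    ≡.trans (≡.cong₂ (Maybe.zipWith _) (⟦close⟧ P ρ) (⟦close⟧ Q ρ)) (zipWith-if (noU P) (noU Q))

_≃_ : SPU → SPU → Set
P ≃ Q = ∀ a v → observe a v P ≡ observe a v Q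

soundness : ∀ P Q → EqClFELU⊢ P Q → P ≃ Q
soundness P Q d a v =
  ≡.trans (≡.sym (⟦close⟧ P ρ)) (≡.trans (sound d ρ) (⟦close⟧ Q ρ))
  where
  open Observation a v
  ρ : ℕ → Obs
  ρ _ = nothing

noU-bool : ∀ b → noU (bool b) ≡ true
noU-bool true = ≡.refl
noU-bool false = ≡.refl

eval-bool : ∀ v b → eval v (bool b) ≡ b
eval-bool v true = ≡.refl
eval-bool v false = ≡.refl

bool-atom-free : ∀ {c} b → ¬ c occursIn bool b
bool-atom-free true ()
bool-atom-free false ()

_[_↦_] : (Atom → Bool) → Atom → Bool → Atom → Bool
(v [ a ↦ b ]) c = if does (a ≟ c) then b else v c

module _ {a : Atom} {b : Bool} where

  noU-≔ : ∀ P → noU (P [ a ≔ b ]) ≡ noU P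
  noU-≔ (var ())
  noU-≔ T = ≡.refl
  noU-≔ F = ≡.refl
  noU-≔ U = ≡.refl
  noU-≔ (atom c) with does (a ≟ c)
  ... | true = noU-bool b
  ... | false = ≡.refl
  noU-≔ (¬′ P) = noU-≔ P
  noU-≔ (P ∧∙ Q) rewrite noU-≔ P | noU-≔ Q = ≡.refl
  noU-≔ (P ∨∙ Q) rewrite noU-≔ P | noU-≔ Q = ≡.refl

  eval-≔ : ∀ v P → eval v (P [ a ≔ b ]) ≡ eval (v [ a ↦ b ]) P
  eval-≔ v (var ())
  eval-≔ v T = ≡.refl
  eval-≔ v F = ≡.refl
  eval-≔ v U = ≡.refl
  eval-≔ v (atom c) with does (a ≟ c)
  ... | true = eval-bool v b
  ... | false = ≡.refl
  eval-≔ v (¬′ P) = ≡.cong not (eval-≔ v P)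
  eval-≔ v (P ∧∙ Q) = ≡.cong₂ _∧_ (eval-≔ v P) (eval-≔ v Q)
  eval-≔ v (P ∨∙ Q) = ≡.cong₂ _∨_ (eval-≔ v P) (eval-≔ v Q)

  occurs-≔⁻ : ∀ {c} P → c occursIn (P [ a ≔ b ]) → c occursIn P × a ≢ c
  occurs-≔⁻ (var ())
  occurs-≔⁻ {c} (atom d) o with does (a ≟ d) | proof (a ≟ d)
  ... | true | ofʸ _ = ⊥-elim (bool-atom-free b o)
  ... | false | ofⁿ a≢d with does (c ≟ d) | proof (c ≟ d)
  ... | true | ofʸ ≡.refl = _ , a≢d
  occurs-≔⁻ (¬′ P) o = occurs-≔⁻ P o
  occurs-≔⁻ (P ∧∙ Q) o with to Boolₚ.T-∨ o
  ... | inj₁ oP = Product.map₁ (λ o → from Boolₚ.T-∨ (inj₁ o)) (occurs-≔⁻ P oP)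
  ... | inj₂ oQ = Product.map₁ (λ o → from Boolₚ.T-∨ (inj₂ o)) (occurs-≔⁻ Q oQ)
  occurs-≔⁻ (P ∨∙ Q) o with to Boolₚ.T-∨ o
  ... | inj₁ oP = Product.map₁ (λ o → from Boolₚ.T-∨ (inj₁ o)) (occurs-≔⁻ P oP)
  ... | inj₂ oQ = Product.map₁ (λ o → from Boolₚ.T-∨ (inj₂ o)) (occurs-≔⁻ Q oQ)

  occurs-≔⁺ : ∀ {c} P → c occursIn P → a ≢ c → c occursIn (P [ a ≔ b ])
  occurs-≔⁺ (var ())
  occurs-≔⁺ {c} (atom d) o a≢c with does (a ≟ d) | proof (a ≟ d)
  ... | false | ofⁿ _ = o
  ... | true | ofʸ ≡.refl with does (c ≟ d) | proof (c ≟ d)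
  ...   | true | ofʸ ≡.refl = ⊥-elim (a≢c ≡.refl)
  occurs-≔⁺ (¬′ P) o a≢c = occurs-≔⁺ P o a≢c
  occurs-≔⁺ (P ∧∙ Q) o a≢c with to Boolₚ.T-∨ o
  ... | inj₁ oP = from Boolₚ.T-∨ (inj₁ (occurs-≔⁺ P oP a≢c))
  ... | inj₂ oQ = from Boolₚ.T-∨ (inj₂ (occurs-≔⁺ Q oQ a≢c))
  occurs-≔⁺ (P ∨∙ Q) o a≢c with to Boolₚ.T-∨ o
  ... | inj₁ oP = from Boolₚ.T-∨ (inj₁ (occurs-≔⁺ P oP a≢c))
  ... | inj₂ oQ = from Boolₚ.T-∨ (inj₂ (occurs-≔⁺ Q oQ a≢c))

_hasAtoms_ : SPU → List Atom → Set
P hasAtoms ρ = ∀ c → c occursIn P ⇔ c ∈ ρ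

hasAtoms-≔ : ∀ {a b ρ} P → Unique (a ∷ ρ) → P hasAtoms (a ∷ ρ) → (P [ a ≔ b ]) hasAtoms ρ
hasAtoms-≔ {a} {b} {ρ} P (a∉ρ ∷ _) atoms c = mk⇔ occurs⇒∈ ∈⇒occurs
  where
  occurs⇒∈ : c occursIn (P [ a ≔ b ]) → c ∈ ρ
  occurs⇒∈ o with occurs-≔⁻ P o
  ... | oP , a≢c with to (atoms c) oP
  ...   | here c≡a = ⊥-elim (a≢c (≡.sym c≡a))
  ...   | there c∈ρ = c∈ρ
  ∈⇒occurs : c ∈ ρ → c occursIn (P [ a ≔ b ])
  ∈⇒occurs c∈ρ = occurs-≔⁺ P (from (atoms c) (there c∈ρ)) (All.lookup a∉ρ c∈ρ)

data Constant : SPU → Set where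
  constT : Constant T
  constF : Constant F
  const¬ : ∀ {P} → Constant P → Constant (¬′ P)
  const∧ : ∀ {P Q} → Constant P → Constant Q → Constant (P ∧∙ Q)
  const∨ : ∀ {P Q} → Constant P → Constant Q → Constant (P ∨∙ Q)

constant : ∀ P → noU P ≡ true → (∀ c → ¬ c occursIn P) → Constant P
constant (var ())
constant T _ _ = constT
constant F _ _ = constF
constant (atom c) _ no-atoms = ⊥-elim (no-atoms c occurs-self)
  where
  occurs-self : c occursIn atom c
  occurs-self with does (c ≟ c) | proof (c ≟ c)
  ... | true | _ = _
  ... | false | ofⁿ c≢c = c≢c ≡.refl
constant (¬′ P) u no-atoms = const¬ (constant P u no-atoms)
constant (P ∧∙ Q) u no-atoms with noU P in uP
... | true = const∧ (constant P uP (λ c o → no-atoms c (from Boolₚ.T-∨ (inj₁ o))))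
                    (constant Q u (λ c o → no-atoms c (from Boolₚ.T-∨ (inj₂ o))))
constant (P ∨∙ Q) u no-atoms with noU P in uP
... | true = const∨ (constant P uP (λ c o → no-atoms c (from Boolₚ.T-∨ (inj₁ o))))
                    (constant Q u (λ c o → no-atoms c (from Boolₚ.T-∨ (inj₂ o))))

constant-value : ∀ v {P} → Constant P → ⊢ close P ≈ bool (eval v P)
constant-value v constT = refl
constant-value v constF = refl
constant-value v (const¬ {P} p) = trans (cong¬ (constant-value v p)) (bool-¬ (eval v P))
constant-value v (const∧ {P} {Q} p q) =
  trans (cong∧ (constant-value v p) (constant-value v q)) (bool-∧ (eval v P) (eval v Q))
constant-value v (const∨ {P} {Q} p q) =
  trans (cong∨ (constant-value v p) (constant-value v q)) (bool-∨ (eval v P) (eval v Q))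

-- Evaluation trees

fromBool : Bool → Tree
fromBool true = Tt
fromBool false = Ft

fe-constant : ∀ v {P} → Constant P → fe P ≡ fromBool (eval v P)
fe-constant v constT = ≡.refl
fe-constant v constF = ≡.refl
fe-constant v (const¬ {P} p) rewrite fe-constant v p with eval v P
... | true = ≡.refl
... | false = ≡.refl
fe-constant v (const∧ {P} {Q} p q) rewrite fe-constant v p | fe-constant v q with eval v P | eval v Q
... | true | _ = ≡.refl
... | false | true = ≡.refl
... | false | false = ≡.refl
fe-constant v (const∨ {P} {Q} p q) rewrite fe-constant v p | fe-constant v q with eval v P | eval v Q
... | false | _ = ≡.refl
... | true | true = ≡.refl
... | true | false = ≡.refl

complete : List Atom → Tree → Tree
complete [] Z = Z
complete (a ∷ ρ) Z = complete ρ Z ⊴ a ⊵ complete ρ Z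

-- Along each path f gets a valuation fixed on ρ; its values elsewhere are arbitrary.
truthTable : List Atom → ((Atom → Bool) → Bool) → Tree
truthTable [] f = fromBool (f (λ _ → false))
truthTable (a ∷ ρ) f =
  truthTable ρ (λ v → f (v [ a ↦ true ])) ⊴ a ⊵ truthTable ρ (λ v → f (v [ a ↦ false ]))

toTerm : Tree → Term ℕ
toTerm Tt = T
toTerm Ft = F
toTerm Ut = U
toTerm (X ⊴ a ⊵ Y) = (atom a ∧∙ toTerm X) ∨∙ (¬′ atom a ∧∙ toTerm Y)

complete-[] : ∀ ρ Z {A B} → (complete ρ Z) [T↦ A ,F↦ B ] ≡ complete ρ (Z [T↦ A ,F↦ B ])
complete-[] [] Z = ≡.refl
complete-[] (a ∷ ρ) Z = ≡.cong (λ X → X ⊴ a ⊵ X) (complete-[] ρ Z)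

fe-F̃ : ∀ ρ → fe (F̃ ρ) ≡ complete ρ Ft
fe-F̃ [] = ≡.refl
fe-F̃ (a ∷ ρ) rewrite fe-F̃ ρ = ≡.cong (complete ρ Ft ⊴ a ⊵_) (complete-[] ρ Ft)

fe-F̃-∨ : ∀ ρ P → fe (F̃ ρ ∨∙ P) ≡ complete ρ (fe P)
fe-F̃-∨ ρ P rewrite fe-F̃ ρ = complete-[] ρ Ft

depth-complete : ∀ ρ Z → depth (complete ρ Z) ≡ length ρ + depth Z
depth-complete [] Z = ≡.refl
depth-complete (a ∷ ρ) Z = ≡.cong suc (≡.trans (ℕₚ.⊔-idem _) (depth-complete ρ Z))

Lt-complete : ∀ {a} ρ Z → All (a ≢_) ρ → Lt a (complete ρ Z) ≡ complete ρ (Lt a Z)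
Lt-complete [] Z [] = ≡.refl
Lt-complete {a} (c ∷ ρ) Z (a≢c ∷ a∉ρ) with does (a ≟ c) | proof (a ≟ c)
... | true | ofʸ a≡c = ⊥-elim (a≢c a≡c)
... | false | _ = ≡.cong (λ X → X ⊴ c ⊵ X) (Lt-complete ρ Z a∉ρ)

Rt-complete : ∀ {a} ρ Z → All (a ≢_) ρ → Rt a (complete ρ Z) ≡ complete ρ (Rt a Z)
Rt-complete [] Z [] = ≡.refl
Rt-complete {a} (c ∷ ρ) Z (a≢c ∷ a∉ρ) with does (a ≟ c) | proof (a ≟ c)
... | true | ofʸ a≡c = ⊥-elim (a≢c a≡c)
... | false | _ = ≡.cong (λ X → X ⊴ c ⊵ X) (Rt-complete ρ Z a∉ρ)

Lt-[] : ∀ a X {Y Z} → Lt a (X [T↦ Y ,F↦ Z ]) ≡ (Lt a X) [T↦ Lt a Y ,F↦ Lt a Z ]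
Lt-[] a Tt = ≡.refl
Lt-[] a Ft = ≡.refl
Lt-[] a Ut = ≡.refl
Lt-[] a (X₁ ⊴ c ⊵ X₂) with does (a ≟ c)
... | true = Lt-[] a X₁
... | false = ≡.cong₂ (_⊴ c ⊵_) (Lt-[] a X₁) (Lt-[] a X₂)

Rt-[] : ∀ a X {Y Z} → Rt a (X [T↦ Y ,F↦ Z ]) ≡ (Rt a X) [T↦ Rt a Y ,F↦ Rt a Z ]
Rt-[] a Tt = ≡.refl
Rt-[] a Ft = ≡.refl
Rt-[] a Ut = ≡.refl
Rt-[] a (X₁ ⊴ c ⊵ X₂) with does (a ≟ c)
... | true = Rt-[] a X₂
... | false = ≡.cong₂ (_⊴ c ⊵_) (Rt-[] a X₁) (Rt-[] a X₂)

Lt-fe : ∀ a P → Lt a (fe P) ≡ fe (P [ a ≔ true ])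
Lt-fe a (var ())
Lt-fe a T = ≡.refl
Lt-fe a F = ≡.refl
Lt-fe a U = ≡.refl
Lt-fe a (atom c) with does (a ≟ c)
... | true = ≡.refl
... | false = ≡.refl
Lt-fe a (¬′ P) rewrite Lt-[] a (fe P) {Ft} {Tt} | Lt-fe a P = ≡.refl
Lt-fe a (P ∧∙ Q) rewrite Lt-[] a (fe P) {fe Q} {fe Q [T↦ Ft ,F↦ Ft ]} | Lt-[] a (fe Q) {Ft} {Ft}
                       | Lt-fe a P | Lt-fe a Q = ≡.refl
Lt-fe a (P ∨∙ Q) rewrite Lt-[] a (fe P) {fe Q [T↦ Tt ,F↦ Tt ]} {fe Q} | Lt-[] a (fe Q) {Tt} {Tt}
                       | Lt-fe a P | Lt-fe a Q = ≡.refl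

Rt-fe : ∀ a P → Rt a (fe P) ≡ fe (P [ a ≔ false ])
Rt-fe a (var ())
Rt-fe a T = ≡.refl
Rt-fe a F = ≡.refl
Rt-fe a U = ≡.refl
Rt-fe a (atom c) with does (a ≟ c)
... | true = ≡.refl
... | false = ≡.refl
Rt-fe a (¬′ P) rewrite Rt-[] a (fe P) {Ft} {Tt} | Rt-fe a P = ≡.refl
Rt-fe a (P ∧∙ Q) rewrite Rt-[] a (fe P) {fe Q} {fe Q [T↦ Ft ,F↦ Ft ]} | Rt-[] a (fe Q) {Ft} {Ft}
                       | Rt-fe a P | Rt-fe a Q = ≡.refl
Rt-fe a (P ∨∙ Q) rewrite Rt-[] a (fe P) {fe Q [T↦ Tt ,F↦ Tt ]} {fe Q} | Rt-[] a (fe Q) {Tt} {Tt}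
                       | Rt-fe a P | Rt-fe a Q = ≡.refl

truthTable-cong : ∀ ρ {f g : (Atom → Bool) → Bool} → (∀ v → f v ≡ g v) → truthTable ρ f ≡ truthTable ρ g
truthTable-cong [] f≗g = ≡.cong fromBool (f≗g _)
truthTable-cong (a ∷ ρ) f≗g =
  ≡.cong₂ (_⊴ a ⊵_) (truthTable-cong ρ (λ v → f≗g _)) (truthTable-cong ρ (λ v → f≗g _))

truthTable-≔ : ∀ ρ a b P →
  truthTable ρ (λ v → eval v (P [ a ≔ b ])) ≡ truthTable ρ (λ v → eval (v [ a ↦ b ]) P)
truthTable-≔ ρ a b P = truthTable-cong ρ (λ v → eval-≔ v P)

atom-free : ∀ {P} → P hasAtoms [] → ∀ c → ¬ c occursIn P
atom-free atoms c o with to (atoms c) o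
... | ()

mfuel-fromBool : ∀ k b → mfuel k (fromBool b) ≡ fromBool b
mfuel-fromBool zero b = ≡.refl
mfuel-fromBool (suc k) true = ≡.refl
mfuel-fromBool (suc k) false = ≡.refl

mfuel-complete-fe : ∀ ρ P k → noU P ≡ true → P hasAtoms ρ → Unique ρ →
  mfuel (length ρ + k) (complete ρ (fe P)) ≡ truthTable ρ (λ v → eval v P)
mfuel-complete-fe [] P k u atoms _ =
  ≡.trans (≡.cong (mfuel k) (fe-constant _ (constant P u (atom-free {P} atoms))))
          (mfuel-fromBool k (eval _ P))
mfuel-complete-fe (a ∷ ρ) P k u atoms uniq@(a∉ρ ∷ uniqρ) =
  ≡.cong₂ (_⊴ a ⊵_) (branch true Lt (Lt-complete ρ (fe P) a∉ρ) (Lt-fe a P))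
                    (branch false Rt (Rt-complete ρ (fe P) a∉ρ) (Rt-fe a P))
  where
  open ≡.≡-Reasoning
  branch : ∀ b (R : Atom → Tree → Tree) →
           R a (complete ρ (fe P)) ≡ complete ρ (R a (fe P)) → R a (fe P) ≡ fe (P [ a ≔ b ]) →
           mfuel (length ρ + k) (R a (complete ρ (fe P))) ≡ truthTable ρ (λ v → eval (v [ a ↦ b ]) P)
  branch b R R-complete R-fe = begin
    mfuel (length ρ + k) (R a (complete ρ (fe P)))        ≡⟨ ≡.cong (mfuel _) R-complete ⟩
    mfuel (length ρ + k) (complete ρ (R a (fe P)))        ≡⟨ ≡.cong (λ X → mfuel _ (complete ρ X)) R-fe ⟩
    mfuel (length ρ + k) (complete ρ (fe (P [ a ≔ b ])))  ≡⟨ mfuel-complete-fe ρ (P [ a ≔ b ]) k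
                                                              (≡.trans (noU-≔ P) u) (hasAtoms-≔ P uniq atoms) uniqρ ⟩
    truthTable ρ (λ v → eval v (P [ a ≔ b ]))             ≡⟨ truthTable-≔ ρ a b P ⟩
    truthTable ρ (λ v → eval (v [ a ↦ b ]) P)             ∎

occurs≤maxAtom : ∀ {c} P → c occursIn P → c ≤ maxAtom P
occurs≤maxAtom (var ())
occurs≤maxAtom {c} (atom d) o with does (c ≟ d) | proof (c ≟ d)
... | true | ofʸ ≡.refl = ℕₚ.≤-refl
occurs≤maxAtom (¬′ P) o = occurs≤maxAtom P o
occurs≤maxAtom (P ∧∙ Q) o with to Boolₚ.T-∨ o
... | inj₁ oP = ℕₚ.≤-trans (occurs≤maxAtom P oP) (ℕₚ.m≤m⊔n _ _)
... | inj₂ oQ = ℕₚ.≤-trans (occurs≤maxAtom Q oQ) (ℕₚ.m≤n⊔m _ _)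
occurs≤maxAtom (P ∨∙ Q) o with to Boolₚ.T-∨ o
... | inj₁ oP = ℕₚ.≤-trans (occurs≤maxAtom P oP) (ℕₚ.m≤m⊔n _ _)
... | inj₂ oQ = ℕₚ.≤-trans (occurs≤maxAtom Q oQ) (ℕₚ.m≤n⊔m _ _)

occurs? : ∀ P → Decidable (λ c → occurs c P ≡ true)
occurs? P c = occurs c P Bool.≟ true

β-hasAtoms : ∀ P → P hasAtoms β P
β-hasAtoms P c = mk⇔
  (λ o → ∈-filter⁺ (occurs? P) (∈-upTo⁺ (s≤s (occurs≤maxAtom P o))) (to Boolₚ.T-≡ o))
  (λ c∈β → from Boolₚ.T-≡ (Product.proj₂ (∈-filter⁻ (occurs? P) c∈β)))

β-unique : ∀ P → Unique (β P)
β-unique P = Uniqueₚ.filter⁺ (occurs? P) (Uniqueₚ.upTo⁺ _)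

module _ {p : Pred ℕ 0ℓ} (p? : Decidable p) where

  filter-upTo-suc : ∀ m → ¬ p m → filter p? (upTo (suc m)) ≡ filter p? (upTo m)
  filter-upTo-suc m ¬pm = begin
    filter p? (upTo (suc m))                    ≡⟨ ≡.cong (filter p?) (upTo-∷ʳ m) ⟨
    filter p? (upTo m ++ [ m ])                 ≡⟨ filter-++ p? (upTo m) [ m ] ⟩
    filter p? (upTo m) ++ filter p? [ m ]       ≡⟨ ≡.cong (filter p? (upTo m) ++_) (filter-reject p? ¬pm) ⟩
    filter p? (upTo m) ++ []                    ≡⟨ ++-identityʳ _ ⟩
    filter p? (upTo m)                          ∎
    where open ≡.≡-Reasoning

  filter-upTo-≥ : ∀ {n} m → (∀ i → n ≤ i → ¬ p i) → n ≤ m → filter p? (upTo m) ≡ filter p? (upTo n)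
  filter-upTo-≥ zero _ z≤n = ≡.refl
  filter-upTo-≥ (suc m) none-above n≤1+m with ℕₚ.m≤n⇒m<n∨m≡n n≤1+m
  ... | inj₂ ≡.refl = ≡.refl
  ... | inj₁ n<1+m = ≡.trans (filter-upTo-suc m (none-above m (s≤s⁻¹ n<1+m)))
                             (filter-upTo-≥ m none-above (s≤s⁻¹ n<1+m))

β-cong : ∀ P Q → (∀ c → occurs c P ≡ occurs c Q) → β P ≡ β Q
β-cong P Q same = begin
  β P                          ≡⟨ filter-upTo-≥ (occurs? P) N (none-above P) (s≤s (ℕₚ.m≤m⊔n _ _)) ⟨
  filter (occurs? P) (upTo N)  ≡⟨ filter-≐ (occurs? P) (occurs? Q) same′ (upTo N) ⟩
  filter (occurs? Q) (upTo N)  ≡⟨ filter-upTo-≥ (occurs? Q) N (none-above Q) (s≤s (ℕₚ.m≤n⊔m _ _)) ⟩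
  β Q                          ∎
  where
  open ≡.≡-Reasoning
  N : ℕ
  N = suc (maxAtom P ⊔ maxAtom Q)
  none-above : ∀ R i → suc (maxAtom R) ≤ i → ¬ occurs i R ≡ true
  none-above R i above o = ℕₚ.<⇒≱ above (occurs≤maxAtom R (from Boolₚ.T-≡ o))
  same′ : (λ c → occurs c P ≡ true) ≐ (λ c → occurs c Q ≡ true)
  same′ = (λ {c} o → ≡.trans (≡.sym (same c)) o) , (λ {c} o → ≡.trans (same c) o)

clfe-truthTable : ∀ P → noU P ≡ true → clfe P ≡ truthTable (β P) (λ v → eval v P)
clfe-truthTable P u = begin
  clfe P                                             ≡⟨ ≡.cong (if_then mfe (F̃ (β P) ∨∙ P) else Ut) u ⟩
  m (fe (F̃ (β P) ∨∙ P))                              ≡⟨ ≡.cong m (fe-F̃-∨ (β P) P) ⟩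
  m (complete (β P) (fe P))                          ≡⟨ ≡.cong (λ n → mfuel n Z) (depth-complete (β P) (fe P)) ⟩
  mfuel (length (β P) + depth (fe P)) Z              ≡⟨ mfuel-complete-fe (β P) P _ u (β-hasAtoms P) (β-unique P) ⟩
  truthTable (β P) (λ v → eval v P)                  ∎
  where
  open ≡.≡-Reasoning
  Z : Tree
  Z = complete (β P) (fe P)

clfe-U : ∀ P → noU P ≡ false → clfe P ≡ Ut
clfe-U P u = ≡.cong (if_then mfe (F̃ (β P) ∨∙ P) else Ut) u

clfe-cong : ∀ P Q → P ≃ Q → clfe P ≡ clfe Q
clfe-cong P Q P≃Q = by-cases (noU P) ≡.refl
  where
  open ≡.≡-Reasoning
  noU-same : noU P ≡ noU Q
  noU-same = if-just-injective (noU P) (noU Q) (P≃Q 0 (λ _ → false))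
  by-cases : ∀ b → noU P ≡ b → clfe P ≡ clfe Q
  by-cases false uP = ≡.trans (clfe-U P uP) (≡.sym (clfe-U Q (≡.trans (≡.sym noU-same) uP)))
  by-cases true uP = begin
    clfe P                               ≡⟨ clfe-truthTable P uP ⟩
    truthTable (β P) (λ v → eval v P)    ≡⟨ ≡.cong (λ ρ → truthTable ρ _) (β-cong P Q same-atoms) ⟩
    truthTable (β Q) (λ v → eval v P)    ≡⟨ truthTable-cong (β Q) same-value ⟩
    truthTable (β Q) (λ v → eval v Q)    ≡⟨ clfe-truthTable Q uQ ⟨
    clfe Q                               ∎
    where
    uQ : noU Q ≡ true
    uQ = ≡.trans (≡.sym noU-same) uP
    same : ∀ a v → (occurs a P , eval v P) ≡ (occurs a Q , eval v Q)
    same a v = Maybeₚ.just-injective (begin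
      just (occurs a P , eval v P)   ≡⟨ ≡.cong (if_then just (occurs a P , eval v P) else nothing) uP ⟨
      observe a v P                  ≡⟨ P≃Q a v ⟩
      observe a v Q                  ≡⟨ ≡.cong (if_then just (occurs a Q , eval v Q) else nothing) uQ ⟩
      just (occurs a Q , eval v Q)   ∎)
    same-atoms : ∀ c → occurs c P ≡ occurs c Q
    same-atoms c = ≡.cong Product.proj₁ (same c (λ _ → false))
    same-value : ∀ v → eval v P ≡ eval v Q
    same-value v = ≡.cong Product.proj₂ (same 0 v)

-- Normal forms

toTerm-fromBool : ∀ b → toTerm (fromBool b) ≡ bool b
toTerm-fromBool true = ≡.refl
toTerm-fromBool false = ≡.refl

normal-form-along : ∀ ρ P → noU P ≡ true → P hasAtoms ρ → Unique ρ →
  ⊢ close P ≈ toTerm (truthTable ρ (λ v → eval v P))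
normal-form-along [] P u atoms _ =
  trans (constant-value _ (constant P u (atom-free {P} atoms))) (⊢-reflexive (≡.sym (toTerm-fromBool _)))
normal-form-along (a ∷ ρ) P u atoms uniq@(_ ∷ uniqρ) =
  trans (shannon-expansion P (from (atoms a) (here ≡.refl)))
        (cong∨ (cong∧ refl (branch true)) (cong∧ refl (branch false)))
  where
  branch : ∀ b → ⊢ close (P [ a ≔ b ]) ≈ toTerm (truthTable ρ (λ v → eval (v [ a ↦ b ]) P))
  branch b = trans (normal-form-along ρ (P [ a ≔ b ]) (≡.trans (noU-≔ P) u) (hasAtoms-≔ P uniq atoms) uniqρ)
                   (⊢-reflexive (≡.cong toTerm (truthTable-≔ ρ a b P)))

normal-form : ∀ P → ⊢ close P ≈ toTerm (clfe P)
normal-form P = by-cases (noU P) ≡.refl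
  where
  by-cases : ∀ b → noU P ≡ b → ⊢ close P ≈ toTerm (clfe P)
  by-cases true u = trans (normal-form-along (β P) P u (β-hasAtoms P) (β-unique P))
                   (⊢-reflexive (≡.cong toTerm (≡.sym (clfe-truthTable P u))))
  by-cases false u = trans (U-absorbs P u) (⊢-reflexive (≡.cong toTerm (≡.sym (clfe-U P u))))

theorem6p13 : (P Q : SPU) → EqClFELU⊢ P Q ⇔ (clfe P ≡ clfe Q)
theorem6p13 P Q = mk⇔ (λ ⊢P≈Q → clfe-cong P Q (soundness P Q ⊢P≈Q)) completeness
  where
  open ⊢-Reasoning
  completeness : clfe P ≡ clfe Q → EqClFELU⊢ P Q
  completeness same = begin
    close P           ≈⟨ normal-form P ⟩
    toTerm (clfe P)   ≡⟨ ≡.cong toTerm same ⟩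
    toTerm (clfe Q)   ≈⟨ normal-form Q ⟨
    close Q           ∎
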